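{- If two semifield spread sets $C(\mathbb{S})$ and $C(\mathbb{S}')$ are equivalent, then the vector rank-metric codes $D(\mathbb{S})$ and $D(\mathbb{S}')$ are equivalent.
   Context: Let $\mathbb{S}$ be a finite semifield whose spread set $C(\mathbb{S})=\{R_y : y\in\mathbb{S}\}$ (with $R_y:x\mapsto x\star y$ the right multiplication maps) is embedded as an $\mathbb{F}_q$-subspace of $M_n(\mathbb{F}_{q^s})$ of $\mathbb{F}_q$-dimension $ns$ in which every nonzero element is invertible. Two $\mathbb{F}_q$-subspaces $C,C'$ of $M_n(\mathbb{F}_{q^s})$ are equivalent if $C'=\{XA^\rho Y : A\in C\}$ for some invertible $X,Y\in M_n(\mathbb{F}_{q^s})$ and a field automorphism $\rho$ of $\mathbb{F}_{q^s}$ (applied entrywise). The vector rank-metric code $D(\mathbb{S})$ is obtained as follows: choose an $\mathbb{F}_q$-basis $\{A_1,\dots,A_{ns}\}$ of $C(\mathbb{S})$, form the matrix $G(\mathbb{S})$ over $\mathbb{F}_{q^s}$ whose columns are the column-major vectorisations $\mathrm{vec}(A_i)\in(\mathbb{F}_{q^s})^{n^2}$, and let $D(\mathbb{S})$ be the $\mathbb{F}_{q^s}$-span of the rows of $G(\mathbb{S})$, an $\mathbb{F}_{q^s}$-linear code in $(\mathbb{F}_{q^s})^{ns}$ of dimension at most $n^2$ (different basis choices give equivalent codes). Two vector rank-metric codes $D,E\subseteq(\mathbb{F}_{q^s})^N$ are equivalent if $E=\{v^\rho Q : v\in D\}$ for some invertible $Q\in M_N(\mathbb{F}_q)$ and field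 automorphism $\rho$ of $\mathbb{F}_{q^s}$. -}

module Defs where

open import Level using (0ℓ)
open import Data.Bool using (Bool; T)
open import Data.Nat using (ℕ; zero; suc; _^_) renaming (_*_ to _*ℕ_)
open import Data.Fin using (Fin; zero; suc; remQuot)
open import Data.Product using (Σ; ∃; _×_; _,_)
open import Function.Bundles using (_↔_)
open import Function.Definitions using (Bijective)
open import Relation.Binary.PropositionalEquality using (_≡_; _≢_)
open import Relation.Nullary using (¬_)
open import Algebra.Structures using (IsCommutativeRing)

-- A finite field K = F_{q^s} together with its subfield F_q.
-- The subfield is given by a Boolean membership test inF; its
-- elements are those x with T (inF x).

record FieldExt : Set₁ where
  field
    K        : Set
    _+_ _*_  : K → K → K
    -_       : K → K
    0# 1#    : K
    isCommutativeRing : IsCommutativeRing _≡_ _+_ _*_ -_ 0# 1#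
    0≢1      : 0# ≢ 1#
    inverse  : ∀ x → x ≢ 0# → Σ K (λ y → x * y ≡ 1#)
    q s      : ℕ
    finiteK  : K ↔ Fin (q ^ s)
    inF      : K → Bool
    F-0      : T (inF 0#)
    F-1      : T (inF 1#)
    F-+      : ∀ {x y} → T (inF x) → T (inF y) → T (inF (x + y))
    F-*      : ∀ {x y} → T (inF x) → T (inF y) → T (inF (x * y))
    F-neg    : ∀ {x} → T (inF x) → T (inF (- x))
    F-inv    : ∀ {x y} → T (inF x) → x * y ≡ 1# → T (inF y)
    finiteF  : Σ K (λ x → T (inF x)) ↔ Fin q

module _ (E : FieldExt) where
  open FieldExt E

  InF : K → Set
  InF x = T (inF x)

  ∑ : ∀ m → (Fin m → K) → K
  ∑ zero    f = 0#
  ∑ (suc m) f = f zero + ∑ m (λ i → f (suc i))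

  record Automorphism : Set where
    field
      ρ       : K → K
      bij     : Bijective _≡_ _≡_ ρ
      ρ-+     : ∀ x y → ρ (x + y) ≡ ρ x + ρ y
      ρ-*     : ∀ x y → ρ (x * y) ≡ ρ x * ρ y
      ρ-1     : ρ 1# ≡ 1#

  -- square n×n matrices over K: entry (i , j) = row i, column j
  Mat : ℕ → Set
  Mat n = Fin n → Fin n → K

  _≋_ : ∀ {n} → Mat n → Mat n → Set
  A ≋ B = ∀ i j → A i j ≡ B i j

  _·_ : ∀ {n} → Mat n → Mat n → Mat n
  _·_ {n} A B i j = ∑ n (λ k → A i k * B k j)

  idM : ∀ {n} → Mat n
  idM {n} i j with i Data.Fin.≟ j
  ... | Relation.Nullary.yes _ = 1#
  ... | Relation.Nullary.no  _ = 0#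

  Invertible : ∀ {n} → Mat n → Set
  Invertible {n} X = Σ (Mat n) (λ Y → ((X · Y) ≋ idM) × ((Y · X) ≋ idM))

  zeroM : ∀ {n} → Mat n
  zeroM i j = 0#

  combo : ∀ {n m} → (Fin m → K) → (Fin m → Mat n) → Mat n
  combo {n} {m} c A i j = ∑ m (λ k → c k * A k i j)

  -- A semifield spread set C(S) ⊆ M_n(F_{q^s}), given together with a
  -- chosen F_q-basis A_1 … A_{ns}: the A_k are F_q-linearly independent
  -- (so dim_{F_q} C = ns) and every nonzero element of their F_q-span
  -- is invertible.
  record SpreadSet (n : ℕ) : Set where
    field
      basis      : Fin (n *ℕ s) → Mat n
      independent : ∀ (c : Fin (n *ℕ s) → K) → (∀ k → InF (c k)) →
                    combo c basis ≋ zeroM → ∀ k → c k ≡ 0#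
      nonsingular : ∀ (c : Fin (n *ℕ s) → K) → (∀ k → InF (c k)) →
                    ¬ (combo c basis ≋ zeroM) → Invertible (combo c basis)

  _∈C_ : ∀ {n} → Mat n → SpreadSet n → Set
  _∈C_ {n} B C = Σ (Fin (n *ℕ s) → K) (λ c →
                   (∀ k → InF (c k)) × (B ≋ combo c (SpreadSet.basis C)))

  _^M_ : ∀ {n} → Mat n → Automorphism → Mat n
  (A ^M σ) i j = Automorphism.ρ σ (A i j)

  SpreadEquivalent : ∀ {n} → SpreadSet n → SpreadSet n → Set
  SpreadEquivalent {n} C C' =
    Σ (Mat n) λ X → Σ (Mat n) λ Y → Σ Automorphism λ σ →
      Invertible X × Invertible Y ×
      (∀ (B : Mat n) → (B ∈C C' → Σ (Mat n) (λ A → A ∈C C × (B ≋ ((X · (A ^M σ)) · Y))))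
                     × (Σ (Mat n) (λ A → A ∈C C × (B ≋ ((X · (A ^M σ)) · Y))) → B ∈C C'))

  -- column-major vectorisation: index r = j * n + i  ↦  A i j
  vec : ∀ {n} → Mat n → Fin (n *ℕ n) → K
  vec {n} A r with remQuot n r
  ... | (j , i) = A i j

  G : ∀ {n} → SpreadSet n → Fin (n *ℕ n) → Fin (n *ℕ s) → K
  G C r k = vec (SpreadSet.basis C k) r

  Vect : ℕ → Set
  Vect N = Fin N → K

  _≈v_ : ∀ {N} → Vect N → Vect N → Set
  v ≈v w = ∀ k → v k ≡ w k

  Code : ℕ → Set₁
  Code N = Vect N → Set

  D : ∀ {n} → SpreadSet n → Code (n *ℕ s)
  D {n} C v = Σ (Fin (n *ℕ n) → K) (λ d →
                v ≈v (λ k → ∑ (n *ℕ n) (λ r → d r * G C r k)))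

  MatN : ℕ → Set
  MatN N = Fin N → Fin N → K

  _⊙_ : ∀ {N} → Vect N → MatN N → Vect N
  _⊙_ {N} v Q k = ∑ N (λ l → v l * Q l k)

  InvertibleOverF : ∀ {N} → MatN N → Set
  InvertibleOverF {N} Q = (∀ i j → InF (Q i j)) ×
    Σ (MatN N) (λ Q' → (∀ i j → InF (Q' i j)) ×
      ((λ i j → ∑ N (λ k → Q i k * Q' k j)) ≋ idM) ×
      ((λ i j → ∑ N (λ k → Q' i k * Q k j)) ≋ idM))

  CodeEquivalent : ∀ {N} → Code N → Code N → Set
  CodeEquivalent {N} Dc Ec =
    Σ (MatN N) λ Q → Σ Automorphism λ σ → InvertibleOverF Q ×
      (∀ (w : Vect N) → (Ec w → Σ (Vect N) (λ v → Dc v × (w ≈v ((λ k → Automorphism.ρ σ (v k)) ⊙ Q))))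
                      × (Σ (Vect N) (λ v → Dc v × (w ≈v ((λ k → Automorphism.ρ σ (v k)) ⊙ Q))) → Ec w))

module Submission where

-- Write T A = X · A^σ · Y.  Each basis matrix B_k of C′ lies in T(C), so B_k = Σ_l P_kl T(A_l) with
-- P_kl = ρ(c_kl) for F_q-coefficients c_kl; as F_q is the set of roots of x^q − x, ρ maps F_q onto
-- itself and P is an F_q-matrix.  Since (B_k) and (T A_l) are both F_q-bases of C′, P is invertible.
-- A word of D(S′) is (tr(W B_k))_k for a matrix W reshaped from its coefficient vector, and
-- tr(W · T A_l) = ρ(tr(W′ A_l)) with W′ = ρ⁻¹(Y W X); hence D(S′) = { v^ρ Pᵀ : v ∈ D(S) }.

open import Level using (0ℓ)
open import Defs using (FieldExt; SpreadSet; SpreadEquivalent; CodeEquivalent; D)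
import Defs
open import Data.Nat using (ℕ; zero; suc) renaming (_+_ to _+ℕ_; _*_ to _*ℕ_)
open import Data.Fin using (Fin; zero; suc; punchIn; _↑ˡ_; _↑ʳ_; combine; remQuot)
open import Data.Fin.Properties using (inj⇒≟; 0≢1+n; suc-injective; punchInᵢ≢i; remQuot-combine)
open import Data.Fin.Permutation using (Permutation; permutation; _⟨$⟩ʳ_)
open import Data.Vec using (Vec; []; _∷_; replicate)
open import Data.Bool.Properties using (T-irrelevant)
open import Data.Product using (Σ; _×_; _,_; proj₁; proj₂)
open import Data.Empty using (⊥-elim)
open import Function using (_∘_)
open import Function.Definitions using (Injective)
open import Function.Bundles using (_↔_; Inverse)
open import Function.Properties.Inverse using (↔⇒↣)
open import Relation.Binary.Bundles using (Setoid)
open import Relation.Binary.Definitions using (DecidableEquality)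
open import Relation.Binary.PropositionalEquality
import Relation.Binary.Reasoning.Setoid
open import Relation.Nullary using (yes; no; ¬_)
open import Relation.Nullary.Decidable using (T?)
open import Algebra.Bundles using (CommutativeRing)
import Algebra.Properties.CommutativeMonoid.Sum as MonoidSum

module FiniteField (E : FieldExt) where
  open FieldExt E using (K; 0≢1; inverse; finiteK; inF; F-0; F-1; F-*; F-inv; q; finiteF)

  K-ring : CommutativeRing 0ℓ 0ℓ
  K-ring = record { isCommutativeRing = FieldExt.isCommutativeRing E }

  open CommutativeRing K-ring public
    using (_+_; _*_; -_; 0#; 1#; +-identityˡ; +-identityʳ; +-assoc; -‿inverseʳ; -‿inverseˡ;
           *-identityˡ; *-identityʳ; *-assoc; *-comm; distribˡ; distribʳ; zeroˡ; zeroʳ;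
           semiring; commutativeSemiring; ring; +-group; *-commutativeMonoid)
  open import Algebra.Properties.Semiring.Exp semiring public using (_^_)
  open import Algebra.Solver.Ring.NaturalCoefficients.Default commutativeSemiring public
    using (solve; _:=_; _:+_; _:*_)
  open import Algebra.Properties.Ring ring using (-1*x≈-x)
  open import Algebra.Properties.Group +-group using (x∙y⁻¹≈ε⇒x≈y; identityˡ-unique)
  open MonoidSum *-commutativeMonoid
    using () renaming (sum to ∏; sum-remove to ∏-remove; sum-cong-≗ to ∏-cong;
                       ∑-permute to ∏-permute; ∑-distrib-+ to ∏-distrib; sum-replicate to ∏-const)

  InF : K → Set
  InF = Defs.InF E

  Automorphism : Set
  Automorphism = Defs.Automorphism E

  _≟_ : DecidableEquality K
  _≟_ = inj⇒≟ (↔⇒↣ finiteK)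

  *-cancelˡ : ∀ {x y z} → x ≢ 0# → x * y ≡ x * z → y ≡ z
  *-cancelˡ {x} {y} {z} x≢0 xy≡xz = begin
      y                ≡⟨ sym (*-identityˡ y) ⟩
      1# * y           ≡⟨ cong (_* y) (sym x⁻¹x≡1) ⟩
      (x⁻¹ * x) * y    ≡⟨ *-assoc x⁻¹ x y ⟩
      x⁻¹ * (x * y)    ≡⟨ cong (x⁻¹ *_) xy≡xz ⟩
      x⁻¹ * (x * z)    ≡⟨ sym (*-assoc x⁻¹ x z) ⟩
      (x⁻¹ * x) * z    ≡⟨ cong (_* z) x⁻¹x≡1 ⟩
      1# * z           ≡⟨ *-identityˡ z ⟩
      z                ∎
    where
      open ≡-Reasoning
      x⁻¹ = proj₁ (inverse x x≢0)
      x⁻¹x≡1 : x⁻¹ * x ≡ 1#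
      x⁻¹x≡1 = trans (*-comm x⁻¹ x) (proj₂ (inverse x x≢0))

  *-≢0 : ∀ {x y} → x ≢ 0# → y ≢ 0# → x * y ≢ 0#
  *-≢0 {x} x≢0 y≢0 xy≡0 = y≢0 (*-cancelˡ x≢0 (trans xy≡0 (sym (zeroʳ x))))

  x*z≡y*z⇒z≡0 : ∀ {x y z} → x ≢ y → x * z ≡ y * z → z ≡ 0#
  x*z≡y*z⇒z≡0 {x} {y} {z} x≢y xz≡yz = *-cancelˡ x-y≢0 (begin
      (x + - y) * z      ≡⟨ distribʳ z x (- y) ⟩
      x * z + - y * z    ≡⟨ cong (_+ - y * z) xz≡yz ⟩
      y * z + - y * z    ≡⟨ sym (distribʳ z y (- y)) ⟩
      (y + - y) * z      ≡⟨ cong (_* z) (-‿inverseʳ y) ⟩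
      0# * z             ≡⟨ zeroˡ z ⟩
      0#                 ≡⟨ sym (zeroʳ (x + - y)) ⟩
      (x + - y) * 0#     ∎)
    where
      open ≡-Reasoning
      x-y≢0 : x + - y ≢ 0#
      x-y≢0 = x≢y ∘ x∙y⁻¹≈ε⇒x≈y x y

  ∏-≢0 : ∀ {m} (f : Fin m → K) → (∀ i → f i ≢ 0#) → ∏ f ≢ 0#
  ∏-≢0 {zero}  f f≢0 = 0≢1 ∘ sym
  ∏-≢0 {suc m} f f≢0 = *-≢0 (f≢0 zero) (∏-≢0 (f ∘ suc) (f≢0 ∘ suc))

  -- c₀ ∷ c₁ ∷ … ∷ cₘ₋₁ stands for the monic polynomial xᵐ + cₘ₋₁ xᵐ⁻¹ + … + c₀.
  monic : ∀ {m} → Vec K m → K → K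
  monic []       x = 1#
  monic (c ∷ cs) x = c + x * monic cs x

  quotient : ∀ {m} → K → Vec K (suc m) → Vec K m
  quotient a (c ∷ [])     = []
  quotient a (c ∷ d ∷ cs) = monic (d ∷ cs) a ∷ quotient a (d ∷ cs)

  -- p(x) = (x − a) · (quotient a p)(x) + p(a), rearranged without subtraction for the semiring solver.
  factor-theorem : ∀ {m} a (p : Vec K (suc m)) x →
                   monic p x + a * monic (quotient a p) x ≡ x * monic (quotient a p) x + monic p a
  factor-theorem a (c ∷ []) x =
    solve 4 (λ a c x one → (c :+ x :* one) :+ a :* one := x :* one :+ (c :+ a :* one)) refl a c x 1#
  factor-theorem a (c ∷ p@(_ ∷ _)) x = begin
      (c + x * P) + a * (r + x * Q)   ≡⟨ solve 6 (λ a c x P Q r → (c :+ x :* P) :+ a :* (r :+ x :* Q)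
                                                         := (c :+ a :* r) :+ x :* (P :+ a :* Q)) refl a c x P Q r ⟩
      (c + a * r) + x * (P + a * Q)   ≡⟨ cong (λ t → (c + a * r) + x * t) (factor-theorem a p x) ⟩
      (c + a * r) + x * (x * Q + r)   ≡⟨ solve 5 (λ a c x Q r → (c :+ a :* r) :+ x :* (x :* Q :+ r)
                                                         := x :* (r :+ x :* Q) :+ (c :+ a :* r)) refl a c x Q r ⟩
      x * (r + x * Q) + (c + a * r)   ∎
    where
      open ≡-Reasoning
      P = monic p x
      Q = monic (quotient a p) x
      r = monic p a

  monic-roots : ∀ {m} (p : Vec K m) (xs : Fin (suc m) → K) → Injective _≡_ _≡_ xs →
                ¬ (∀ i → monic p (xs i) ≡ 0#)
  monic-roots []          xs _      roots = 0≢1 (sym (roots zero))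
  monic-roots p@(_ ∷ _) xs xs-inj roots =
    monic-roots (quotient a p) (xs ∘ suc) (suc-injective ∘ xs-inj) quotient-roots
    where
      a = xs zero
      quotient-roots : ∀ i → monic (quotient a p) (xs (suc i)) ≡ 0#
      quotient-roots i = x*z≡y*z⇒z≡0 (0≢1+n ∘ xs-inj) (begin
          a * Q               ≡⟨ sym (+-identityˡ (a * Q)) ⟩
          0# + a * Q          ≡⟨ cong (_+ a * Q) (sym (roots (suc i))) ⟩
          monic p b + a * Q   ≡⟨ factor-theorem a p b ⟩
          b * Q + monic p a   ≡⟨ cong (b * Q +_) (roots zero) ⟩
          b * Q + 0#          ≡⟨ +-identityʳ (b * Q) ⟩
          b * Q               ∎)
        where
          open ≡-Reasoning
          b = xs (suc i)
          Q = monic (quotient a p) b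

  monic-zeros : ∀ k x → monic (replicate k 0#) x ≡ x ^ k
  monic-zeros zero    x = refl
  monic-zeros (suc k) x = trans (+-identityˡ _) (cong (x *_) (monic-zeros k x))

  -- the polynomial x^(k+2) − x
  frobenius : ∀ k → Vec K (suc (suc k))
  frobenius k = 0# ∷ - 1# ∷ replicate k 0#

  frobenius-root : ∀ k {x} → x ^ suc (suc k) ≡ x → monic (frobenius k) x ≡ 0#
  frobenius-root k {x} fixed = begin
      0# + x * (- 1# + x * monic (replicate k 0#) x)   ≡⟨ +-identityˡ _ ⟩
      x * (- 1# + x * monic (replicate k 0#) x)        ≡⟨ cong (λ t → x * (- 1# + x * t)) (monic-zeros k x) ⟩
      x * (- 1# + x ^ suc k)                           ≡⟨ distribˡ x (- 1#) (x ^ suc k) ⟩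
      x * - 1# + x ^ suc (suc k)                       ≡⟨ cong₂ _+_ (trans (*-comm x (- 1#)) (-1*x≈-x x)) fixed ⟩
      - x + x                                          ≡⟨ -‿inverseˡ x ⟩
      0#                                               ∎
    where open ≡-Reasoning

  -- φ replaces 0 by 1: a product of φ over all of F is the product over its nonzero elements.
  φ : K → K
  φ y with y ≟ 0#
  ... | yes _ = 1#
  ... | no  _ = y

  φ-0 : φ 0# ≡ 1#
  φ-0 with 0# ≟ 0#
  ... | yes _   = refl
  ... | no 0≢0 = ⊥-elim (0≢0 refl)

  φ-≢0 : ∀ {y} → y ≢ 0# → φ y ≡ y
  φ-≢0 {y} y≢0 with y ≟ 0#
  ... | yes y≡0 = ⊥-elim (y≢0 y≡0)
  ... | no  _   = refl

  ∏-φ : ∀ {m} (f : Fin (suc m) → K) {z} → f z ≡ 0# → (∀ j → f (punchIn z j) ≢ 0#) →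
        ∏ (φ ∘ f) ≡ ∏ (f ∘ punchIn z)
  ∏-φ f {z} fz≡0 f≢0 = begin
      ∏ (φ ∘ f)                          ≡⟨ ∏-remove {i = z} (φ ∘ f) ⟩
      φ (f z) * ∏ (φ ∘ f ∘ punchIn z)    ≡⟨ cong₂ _*_ (trans (cong φ fz≡0) φ-0) (∏-cong (φ-≢0 ∘ f≢0)) ⟩
      1# * ∏ (f ∘ punchIn z)             ≡⟨ *-identityˡ _ ⟩
      ∏ (f ∘ punchIn z)                  ∎
    where open ≡-Reasoning

  module Enumeration {m} (enum : Σ K InF ↔ Fin (suc m)) where
    open Inverse enum using (to; from; strictlyInverseˡ; strictlyInverseʳ)

    elt : Fin (suc m) → K
    elt = proj₁ ∘ from

    elt-∈F : ∀ i → InF (elt i)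
    elt-∈F = proj₂ ∘ from

    elt-index : ∀ {x} (x∈F : InF x) → elt (to (x , x∈F)) ≡ x
    elt-index x∈F = cong proj₁ (strictlyInverseʳ (_ , x∈F))

    index-elt : ∀ {i x} (x∈F : InF x) → elt i ≡ x → to (x , x∈F) ≡ i
    index-elt {i} x∈F refl = trans (cong (to ∘ (elt i ,_)) (T-irrelevant x∈F (elt-∈F i))) (strictlyInverseˡ i)

    elt-injective : Injective _≡_ _≡_ elt
    elt-injective {i} {j} elt-i≡elt-j = trans (sym (index-elt (elt-∈F j) elt-i≡elt-j)) (index-elt (elt-∈F j) refl)

    multiplication : ∀ {x} → InF x → x ≢ 0# → Permutation (suc m) (suc m)
    multiplication {x} x∈F x≢0 = permutation (scale x∈F) (scale x⁻¹∈F) (scale-cancel xx⁻¹≡1) (scale-cancel x⁻¹x≡1)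
      where
        x⁻¹ = proj₁ (inverse x x≢0)
        xx⁻¹≡1 = proj₂ (inverse x x≢0)
        x⁻¹x≡1 = trans (*-comm x⁻¹ x) xx⁻¹≡1
        x⁻¹∈F = F-inv x∈F xx⁻¹≡1
        scale : ∀ {y} → InF y → Fin (suc m) → Fin (suc m)
        scale y∈F i = to (_ , F-* y∈F (elt-∈F i))
        scale-cancel : ∀ {y z} {y∈F : InF y} {z∈F : InF z} → y * z ≡ 1# → ∀ i → scale y∈F (scale z∈F i) ≡ i
        scale-cancel {y} {z} yz≡1 i = elt-injective (begin
            elt (scale _ (scale _ i))   ≡⟨ elt-index _ ⟩
            y * elt (scale _ i)         ≡⟨ cong (y *_) (elt-index _) ⟩
            y * (z * elt i)             ≡⟨ sym (*-assoc y z (elt i)) ⟩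
            (y * z) * elt i             ≡⟨ cong (_* elt i) yz≡1 ⟩
            1# * elt i                  ≡⟨ *-identityˡ (elt i) ⟩
            elt i                       ∎)
          where open ≡-Reasoning

    -- y ↦ x·y permutes F, so ∏_{y ∈ F*} y = ∏_{y ∈ F*} x·y = xᵐ ∏_{y ∈ F*} y.
    x^m≡1 : ∀ {x} → InF x → x ≢ 0# → x ^ m ≡ 1#
    x^m≡1 {x} x∈F x≢0 = sym (*-cancelˡ R≢0 (begin
        R * 1#                               ≡⟨ *-identityʳ R ⟩
        R                                    ≡⟨ sym (∏-φ elt elt-z≡0 elt≢0) ⟩
        ∏ (φ ∘ elt)                          ≡⟨ ∏-permute (φ ∘ elt) (multiplication x∈F x≢0) ⟩
        ∏ (φ ∘ elt ∘ (multiplication x∈F x≢0 ⟨$⟩ʳ_))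
                                             ≡⟨ ∏-cong (λ i → cong φ (elt-index (F-* x∈F (elt-∈F i)))) ⟩
        ∏ (φ ∘ (x *_) ∘ elt)                 ≡⟨ ∏-φ ((x *_) ∘ elt) (trans (cong (x *_) elt-z≡0) (zeroʳ x))
                                                    (λ j → *-≢0 x≢0 (elt≢0 j)) ⟩
        ∏ (λ j → x * elt (punchIn z j))      ≡⟨ ∏-distrib {m} (λ _ → x) (elt ∘ punchIn z) ⟩
        ∏ {m} (λ _ → x) * R                  ≡⟨ cong (_* R) (∏-const m) ⟩
        x ^ m * R                            ≡⟨ *-comm (x ^ m) R ⟩
        R * x ^ m                            ∎))
      where
        open ≡-Reasoning
        z = to (0# , F-0)
        elt-z≡0 = elt-index F-0
        elt≢0 : ∀ j → elt (punchIn z j) ≢ 0#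
        elt≢0 j e = punchInᵢ≢i z j (elt-injective (trans e (sym elt-z≡0)))
        R = ∏ (elt ∘ punchIn z)
        R≢0 = ∏-≢0 (elt ∘ punchIn z) elt≢0

    root∈F : ∀ (p : Vec K (suc m)) → (∀ i → monic p (elt i) ≡ 0#) → ∀ {r} → monic p r ≡ 0# → InF r
    root∈F p vanishes {r} pr≡0 with T? (inF r)
    ... | yes r∈F = r∈F
    ... | no  r∉F = ⊥-elim (monic-roots p xs xs-injective xs-roots)
      where
        xs : Fin (suc (suc m)) → K
        xs zero    = r
        xs (suc i) = elt i
        elt≢r : ∀ i → elt i ≢ r
        elt≢r i elt-i≡r = r∉F (subst InF elt-i≡r (elt-∈F i))
        xs-injective : Injective _≡_ _≡_ xs
        xs-injective {zero}  {zero}  _ = refl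
        xs-injective {zero}  {suc j} e = ⊥-elim (elt≢r j (sym e))
        xs-injective {suc i} {zero}  e = ⊥-elim (elt≢r i e)
        xs-injective {suc i} {suc j} e = cong suc (elt-injective e)
        xs-roots : ∀ i → monic p (xs i) ≡ 0#
        xs-roots zero    = pr≡0
        xs-roots (suc i) = vanishes i

  ∈F⇒x^Q≡x : ∀ {Q} → Σ K InF ↔ Fin Q → ∀ {x} → InF x → x ^ Q ≡ x
  ∈F⇒x^Q≡x {zero} enum _ with Inverse.to enum (0# , F-0)
  ... | ()
  ∈F⇒x^Q≡x {suc m} enum {x} x∈F with x ≟ 0#
  ... | yes refl = zeroˡ (0# ^ m)
  ... | no  x≢0 = trans (cong (x *_) (x^m≡1 x∈F x≢0)) (*-identityʳ x)
    where open Enumeration enum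

  x^Q≡x⇒∈F : ∀ {Q} → Σ K InF ↔ Fin Q → ∀ {x} → x ^ Q ≡ x → InF x
  x^Q≡x⇒∈F {zero} enum _ with Inverse.to enum (0# , F-0)
  ... | ()
  x^Q≡x⇒∈F {suc zero} enum _ = ⊥-elim (0≢1 (begin
      0#                       ≡⟨ sym (elt-index F-0) ⟩
      elt (to (0# , F-0))      ≡⟨ cong elt (Fin1-unique (to (0# , F-0)) (to (1# , F-1))) ⟩
      elt (to (1# , F-1))      ≡⟨ elt-index F-1 ⟩
      1#                       ∎))
    where
      open Enumeration enum
      open Inverse enum using (to)
      open ≡-Reasoning
      Fin1-unique : (i j : Fin 1) → i ≡ j
      Fin1-unique zero zero = refl
  x^Q≡x⇒∈F {suc (suc k)} enum x-fixed =
    root∈F (frobenius k) (λ i → frobenius-root k (∈F⇒x^Q≡x enum (elt-∈F i))) (frobenius-root k x-fixed)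
    where open Enumeration enum

  module AutomorphismProperties (σ : Automorphism) where
    open Defs.Automorphism σ

    ρ-0 : ρ 0# ≡ 0#
    ρ-0 = identityˡ-unique (ρ 0#) (ρ 0#) (trans (sym (ρ-+ 0# 0#)) (cong ρ (+-identityˡ 0#)))

    ρ-^ : ∀ x k → ρ (x ^ k) ≡ ρ x ^ k
    ρ-^ x zero    = ρ-1
    ρ-^ x (suc k) = trans (ρ-* x (x ^ k)) (cong (ρ x *_) (ρ-^ x k))

    ρ-injective : ∀ {x y} → ρ x ≡ ρ y → x ≡ y
    ρ-injective = proj₁ bij

    ρ⁻¹ : K → K
    ρ⁻¹ y = proj₁ (proj₂ bij y)

    ρ-ρ⁻¹ : ∀ y → ρ (ρ⁻¹ y) ≡ y
    ρ-ρ⁻¹ y = proj₂ (proj₂ bij y) refl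

    ρ-∈F : ∀ {x} → InF x → InF (ρ x)
    ρ-∈F {x} x∈F = x^Q≡x⇒∈F finiteF (trans (sym (ρ-^ x q)) (cong ρ (∈F⇒x^Q≡x finiteF x∈F)))

    ρ⁻¹-∈F : ∀ {y} → InF y → InF (ρ⁻¹ y)
    ρ⁻¹-∈F {y} y∈F = x^Q≡x⇒∈F finiteF (ρ-injective (begin
        ρ (ρ⁻¹ y ^ q)    ≡⟨ ρ-^ (ρ⁻¹ y) q ⟩
        ρ (ρ⁻¹ y) ^ q    ≡⟨ cong (_^ q) (ρ-ρ⁻¹ y) ⟩
        y ^ q            ≡⟨ ∈F⇒x^Q≡x finiteF y∈F ⟩
        y                ≡⟨ sym (ρ-ρ⁻¹ y) ⟩
        ρ (ρ⁻¹ y)        ∎))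
      where open ≡-Reasoning

module Matrices (E : FieldExt) where
  open FiniteField E
  open FieldExt E using (K; F-0; F-1; F-+; F-*; F-neg)
  open import Algebra.Properties.Semiring.Sum semiring
    using (sum; sum-cong-≗; sum-remove; sum-replicate-zero; ∑-distrib-+; *-distribˡ-sum; *-distribʳ-sum)
  open import Algebra.Properties.Ring ring using (-1*x≈-x; -‿distribˡ-*)
  open import Algebra.Properties.Group +-group using (x∙y⁻¹≈ε⇒x≈y)

  ∑ : ∀ m → (Fin m → K) → K
  ∑ = Defs.∑ E

  ∑-syntax : ∀ m → (Fin m → K) → K
  ∑-syntax = ∑

  infix 5 ∑-syntax
  syntax ∑-syntax m (λ k → t) = ∑[ k < m ] t

  ∑≡sum : ∀ m (f : Fin m → K) → ∑ m f ≡ sum f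
  ∑≡sum zero    f = refl
  ∑≡sum (suc m) f = cong (f zero +_) (∑≡sum m (f ∘ suc))

  ∑-cong : ∀ m {f g : Fin m → K} → (∀ i → f i ≡ g i) → ∑ m f ≡ ∑ m g
  ∑-cong m {f} {g} f≗g rewrite ∑≡sum m f | ∑≡sum m g = sum-cong-≗ f≗g

  ∑-0 : ∀ m → ∑[ i < m ] 0# ≡ 0#
  ∑-0 m rewrite ∑≡sum m (λ _ → 0#) = sum-replicate-zero m

  ∑-+ : ∀ m (f g : Fin m → K) → ∑[ i < m ] (f i + g i) ≡ ∑ m f + ∑ m g
  ∑-+ m f g rewrite ∑≡sum m f | ∑≡sum m g | ∑≡sum m (λ i → f i + g i) = ∑-distrib-+ f g

  *-distribˡ-∑ : ∀ m x (f : Fin m → K) → x * ∑ m f ≡ ∑[ i < m ] (x * f i)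
  *-distribˡ-∑ m x f rewrite ∑≡sum m f | ∑≡sum m (λ i → x * f i) = *-distribˡ-sum x f

  *-distribʳ-∑ : ∀ m x (f : Fin m → K) → ∑ m f * x ≡ ∑[ i < m ] (f i * x)
  *-distribʳ-∑ m x f rewrite ∑≡sum m f | ∑≡sum m (λ i → f i * x) = *-distribʳ-sum x f

  ∑-neg : ∀ m (f : Fin m → K) → ∑[ i < m ] (- f i) ≡ - ∑ m f
  ∑-neg m f = begin
      ∑[ i < m ] (- f i)        ≡⟨ ∑-cong m (λ i → sym (-1*x≈-x (f i))) ⟩
      ∑[ i < m ] (- 1# * f i)   ≡⟨ sym (*-distribˡ-∑ m (- 1#) f) ⟩
      - 1# * ∑ m f              ≡⟨ -1*x≈-x (∑ m f) ⟩
      - ∑ m f                   ∎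
    where open ≡-Reasoning

  ∑-comm : ∀ m p (f : Fin m → Fin p → K) → ∑[ i < m ] ∑[ j < p ] f i j ≡ ∑[ j < p ] ∑[ i < m ] f i j
  ∑-comm zero    p f = sym (∑-0 p)
  ∑-comm (suc m) p f = trans (cong (∑ p (f zero) +_) (∑-comm m p (f ∘ suc))) (sym (∑-+ p (f zero) _))

  ∑-remove : ∀ {m} (i : Fin (suc m)) (f : Fin (suc m) → K) → ∑ (suc m) f ≡ f i + (∑[ j < m ] f (punchIn i j))
  ∑-remove {m} i f rewrite ∑≡sum (suc m) f | ∑≡sum m (f ∘ punchIn i) = sum-remove {i = i} f

  ∑-↑ : ∀ a {b} (f : Fin (a +ℕ b) → K) →
        ∑ (a +ℕ b) f ≡ (∑[ i < a ] f (i ↑ˡ b)) + (∑[ j < b ] f (a ↑ʳ j))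
  ∑-↑ zero    f = sym (+-identityˡ _)
  ∑-↑ (suc a) f = trans (cong (f zero +_) (∑-↑ a (f ∘ suc))) (sym (+-assoc _ _ _))

  ∑-combine : ∀ m p (f : Fin (m *ℕ p) → K) → ∑ (m *ℕ p) f ≡ ∑[ i < m ] ∑[ j < p ] f (combine i j)
  ∑-combine zero    p f = refl
  ∑-combine (suc m) p f =
    trans (∑-↑ p f) (cong ((∑[ j < p ] f (combine {suc m} zero j)) +_) (∑-combine m p (f ∘ (p ↑ʳ_))))

  ∑-∈F : ∀ m {f : Fin m → K} → (∀ i → InF (f i)) → InF (∑ m f)
  ∑-∈F zero    f∈F = F-0
  ∑-∈F (suc m) f∈F = F-+ (f∈F zero) (∑-∈F m (f∈F ∘ suc))

  Mat : ℕ → Set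
  Mat = Defs.Mat E

  infix 4 _≋_
  _≋_ : ∀ {n} → Mat n → Mat n → Set
  _≋_ = Defs._≋_ E

  infixl 7 _·_
  _·_ : ∀ {n} → Mat n → Mat n → Mat n
  _·_ = Defs._·_ E

  idM : ∀ {n} → Mat n
  idM = Defs.idM E

  zeroM : ∀ {n} → Mat n
  zeroM = Defs.zeroM E

  combo : ∀ {n m} → (Fin m → K) → (Fin m → Mat n) → Mat n
  combo = Defs.combo E

  ≋-refl : ∀ {n} {A : Mat n} → A ≋ A
  ≋-refl _ _ = refl

  ≋-sym : ∀ {n} {A B : Mat n} → A ≋ B → B ≋ A
  ≋-sym A≋B i j = sym (A≋B i j)

  ≋-trans : ∀ {n} {A B C : Mat n} → A ≋ B → B ≋ C → A ≋ C
  ≋-trans A≋B B≋C i j = trans (A≋B i j) (B≋C i j)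

  ≋-setoid : ℕ → Setoid 0ℓ 0ℓ
  ≋-setoid n = record
    { Carrier       = Mat n
    ; _≈_           = _≋_
    ; isEquivalence = record { refl = ≋-refl ; sym = ≋-sym ; trans = ≋-trans }
    }

  module ≋-Reasoning {n} = Relation.Binary.Reasoning.Setoid (≋-setoid n)

  idM-diag : ∀ {n} (i : Fin n) → idM i i ≡ 1#
  idM-diag i with i Data.Fin.≟ i
  ... | yes _   = refl
  ... | no i≢i = ⊥-elim (i≢i refl)

  idM-offdiag : ∀ {n} {i j : Fin n} → i ≢ j → idM i j ≡ 0#
  idM-offdiag {i = i} {j} i≢j with i Data.Fin.≟ j
  ... | yes i≡j = ⊥-elim (i≢j i≡j)
  ... | no  _   = refl

  idM-sym : ∀ {n} (i j : Fin n) → idM i j ≡ idM j i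
  idM-sym i j with i Data.Fin.≟ j
  ... | yes refl = sym (idM-diag i)
  ... | no  i≢j  = sym (idM-offdiag (i≢j ∘ sym))

  idM-∈F : ∀ {n} (i j : Fin n) → InF (idM i j)
  idM-∈F i j with i Data.Fin.≟ j
  ... | yes _ = F-1
  ... | no  _ = F-0

  ∑-δ : ∀ {n} (i : Fin n) (f : Fin n → K) → ∑[ k < n ] idM i k * f k ≡ f i
  ∑-δ {suc n} i f = begin
      ∑[ k < suc n ] idM i k * f k       ≡⟨ ∑-remove i (λ k → idM i k * f k) ⟩
      idM i i * f i + (∑[ j < n ] idM i (punchIn i j) * f (punchIn i j))
                                         ≡⟨ cong₂ _+_ (cong (_* f i) (idM-diag i)) (∑-cong n off-diagonal) ⟩
      1# * f i + (∑[ j < n ] 0#)         ≡⟨ cong₂ _+_ (*-identityˡ (f i)) (∑-0 n) ⟩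
      f i + 0#                           ≡⟨ +-identityʳ (f i) ⟩
      f i                                ∎
    where
      open ≡-Reasoning
      off-diagonal : ∀ j → idM i (punchIn i j) * f (punchIn i j) ≡ 0#
      off-diagonal j = trans (cong (_* f (punchIn i j)) (idM-offdiag (punchInᵢ≢i i j ∘ sym))) (zeroˡ _)

  ∑-δʳ : ∀ {n} (i : Fin n) (f : Fin n → K) → ∑[ k < n ] f k * idM k i ≡ f i
  ∑-δʳ {n} i f = trans (∑-cong n (λ k → trans (*-comm (f k) _) (cong (_* f k) (idM-sym k i)))) (∑-δ i f)

  ·-assoc : ∀ {n} (A B C : Mat n) → (A · B) · C ≋ A · (B · C)
  ·-assoc {n} A B C i j = begin
      ∑[ k < n ] (∑[ l < n ] A i l * B l k) * C k j   ≡⟨ ∑-cong n (λ k → *-distribʳ-∑ n (C k j) _) ⟩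
      ∑[ k < n ] ∑[ l < n ] A i l * B l k * C k j     ≡⟨ ∑-comm n n _ ⟩
      ∑[ l < n ] ∑[ k < n ] A i l * B l k * C k j     ≡⟨ ∑-cong n (λ l → ∑-cong n (λ k → *-assoc _ _ _)) ⟩
      ∑[ l < n ] ∑[ k < n ] A i l * (B l k * C k j)   ≡⟨ ∑-cong n (λ l → sym (*-distribˡ-∑ n (A i l) _)) ⟩
      ∑[ l < n ] A i l * (∑[ k < n ] B l k * C k j)   ∎
    where open ≡-Reasoning

  ·-cong : ∀ {n} {A A′ B B′ : Mat n} → A ≋ A′ → B ≋ B′ → A · B ≋ A′ · B′
  ·-cong {n} A≋A′ B≋B′ i j = ∑-cong n (λ k → cong₂ _*_ (A≋A′ i k) (B≋B′ k j))

  ·-identityˡ : ∀ {n} (A : Mat n) → idM · A ≋ A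
  ·-identityˡ A i j = ∑-δ i (λ k → A k j)

  ·-identityʳ : ∀ {n} (A : Mat n) → A · idM ≋ A
  ·-identityʳ A i j = ∑-δʳ j (A i)

  ·-zeroˡ : ∀ {n} (A : Mat n) → zeroM · A ≋ zeroM
  ·-zeroˡ {n} A i j = trans (∑-cong n (λ k → zeroˡ (A k j))) (∑-0 n)

  ·-zeroʳ : ∀ {n} (A : Mat n) → A · zeroM ≋ zeroM
  ·-zeroʳ {n} A i j = trans (∑-cong n (λ k → zeroʳ (A i k))) (∑-0 n)

  ·-∈F : ∀ {n} {A B : Mat n} → (∀ i j → InF (A i j)) → (∀ i j → InF (B i j)) → ∀ i j → InF ((A · B) i j)
  ·-∈F {n} A∈F B∈F i j = ∑-∈F n (λ k → F-* (A∈F i k) (B∈F k j))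

  _ᵀ : ∀ {n} → Mat n → Mat n
  (A ᵀ) i j = A j i

  ᵀ-inverse : ∀ {n} {A B : Mat n} → A · B ≋ idM → B ᵀ · A ᵀ ≋ idM
  ᵀ-inverse {n} {A} {B} AB≋I i j = begin
      ∑[ k < n ] B k i * A j k   ≡⟨ ∑-cong n (λ k → *-comm (B k i) (A j k)) ⟩
      ∑[ k < n ] A j k * B k i   ≡⟨ AB≋I j i ⟩
      idM j i                    ≡⟨ idM-sym j i ⟩
      idM i j                    ∎
    where open ≡-Reasoning

  tr : ∀ {n} → Mat n → K
  tr {n} A = ∑[ i < n ] A i i

  tr-cong : ∀ {n} {A B : Mat n} → A ≋ B → tr A ≡ tr B
  tr-cong {n} A≋B = ∑-cong n (λ i → A≋B i i)

  tr-· : ∀ {n} (A B : Mat n) → tr (A · B) ≡ tr (B · A)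
  tr-· {n} A B =
    trans (∑-comm n n (λ i k → A i k * B k i)) (∑-cong n (λ k → ∑-cong n (λ i → *-comm (A i k) (B k i))))

  Independent : ∀ {n m} → (Fin m → Mat n) → Set
  Independent {n} {m} V = ∀ (c : Fin m → K) → (∀ k → InF (c k)) → combo c V ≋ zeroM → ∀ k → c k ≡ 0#

  combo-δ : ∀ {n m} (V : Fin m → Mat n) k → V k ≋ combo (idM k) V
  combo-δ V k i j = sym (∑-δ k (λ l → V l i j))

  combo-congʳ : ∀ {n m} (c : Fin m → K) {V W : Fin m → Mat n} → (∀ k → V k ≋ W k) → combo c V ≋ combo c W
  combo-congʳ {m = m} c V≋W i j = ∑-cong m (λ k → cong (c k *_) (V≋W k i j))

  combo-combo : ∀ {n m p} (a : Fin p → K) (b : Fin p → Fin m → K) (V : Fin m → Mat n) →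
                combo a (λ l → combo (b l) V) ≋ combo (λ k → ∑[ l < p ] a l * b l k) V
  combo-combo {m = m} {p} a b V i j = begin
      ∑[ l < p ] a l * (∑[ k < m ] b l k * V k i j)   ≡⟨ ∑-cong p (λ l → *-distribˡ-∑ m (a l) _) ⟩
      ∑[ l < p ] ∑[ k < m ] a l * (b l k * V k i j)   ≡⟨ ∑-comm p m _ ⟩
      ∑[ k < m ] ∑[ l < p ] a l * (b l k * V k i j)   ≡⟨ ∑-cong m (λ k → ∑-cong p (λ l → sym (*-assoc _ _ _))) ⟩
      ∑[ k < m ] ∑[ l < p ] a l * b l k * V k i j     ≡⟨ ∑-cong m (λ k → sym (*-distribʳ-∑ p (V k i j) _)) ⟩
      ∑[ k < m ] (∑[ l < p ] a l * b l k) * V k i j   ∎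
    where open ≡-Reasoning

  combo-injective : ∀ {n m} {V : Fin m → Mat n} → Independent V → ∀ {a b} →
                    (∀ k → InF (a k)) → (∀ k → InF (b k)) → combo a V ≋ combo b V → ∀ k → a k ≡ b k
  combo-injective {m = m} {V} V-indep {a} {b} a∈F b∈F a≋b k =
    x∙y⁻¹≈ε⇒x≈y (a k) (b k)
      (V-indep (λ l → a l + - b l) (λ l → F-+ (a∈F l) (F-neg (b∈F l))) difference≋0 k)
    where
      difference≋0 : combo (λ l → a l + - b l) V ≋ zeroM
      difference≋0 i j = begin
          ∑[ l < m ] (a l + - b l) * V l i j               ≡⟨ ∑-cong m (λ l → trans (distribʳ _ _ _)
                                                                  (cong (a l * V l i j +_) (sym (-‿distribˡ-* _ _)))) ⟩
          ∑[ l < m ] (a l * V l i j + - (b l * V l i j))  ≡⟨ ∑-+ m _ _ ⟩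
          combo a V i j + (∑[ l < m ] - (b l * V l i j))  ≡⟨ cong₂ _+_ (a≋b i j) (∑-neg m _) ⟩
          combo b V i j + - combo b V i j                  ≡⟨ -‿inverseʳ _ ⟩
          0#                                                ∎
        where open ≡-Reasoning

  ·-combo : ∀ {n m} (X : Mat n) (c : Fin m → K) (V : Fin m → Mat n) → X · combo c V ≋ combo c (λ l → X · V l)
  ·-combo {n} {m} X c V i j = begin
      ∑[ k < n ] X i k * (∑[ l < m ] c l * V l k j)   ≡⟨ ∑-cong n (λ k → *-distribˡ-∑ m (X i k) _) ⟩
      ∑[ k < n ] ∑[ l < m ] X i k * (c l * V l k j)   ≡⟨ ∑-comm n m _ ⟩
      ∑[ l < m ] ∑[ k < n ] X i k * (c l * V l k j)   ≡⟨ ∑-cong m (λ l → ∑-cong n (λ k → swap (X i k) (c l) (V l k j))) ⟩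
      ∑[ l < m ] ∑[ k < n ] c l * (X i k * V l k j)   ≡⟨ ∑-cong m (λ l → sym (*-distribˡ-∑ n (c l) _)) ⟩
      ∑[ l < m ] c l * (∑[ k < n ] X i k * V l k j)   ∎
    where
      open ≡-Reasoning
      swap : ∀ x c v → x * (c * v) ≡ c * (x * v)
      swap = solve 3 (λ x c v → x :* (c :* v) := c :* (x :* v)) refl

  combo-· : ∀ {n m} (c : Fin m → K) (V : Fin m → Mat n) (Y : Mat n) → combo c V · Y ≋ combo c (λ l → V l · Y)
  combo-· {n} {m} c V Y i j = begin
      ∑[ k < n ] (∑[ l < m ] c l * V l i k) * Y k j   ≡⟨ ∑-cong n (λ k → *-distribʳ-∑ m (Y k j) _) ⟩
      ∑[ k < n ] ∑[ l < m ] c l * V l i k * Y k j     ≡⟨ ∑-comm n m _ ⟩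
      ∑[ l < m ] ∑[ k < n ] c l * V l i k * Y k j     ≡⟨ ∑-cong m (λ l → ∑-cong n (λ k → *-assoc _ _ _)) ⟩
      ∑[ l < m ] ∑[ k < n ] c l * (V l i k * Y k j)   ≡⟨ ∑-cong m (λ l → sym (*-distribˡ-∑ n (c l) _)) ⟩
      ∑[ l < m ] c l * (∑[ k < n ] V l i k * Y k j)   ∎
    where open ≡-Reasoning

  tr-combo : ∀ {n m} (c : Fin m → K) (V : Fin m → Mat n) → tr (combo c V) ≡ ∑[ l < m ] c l * tr (V l)
  tr-combo {n} {m} c V = trans (∑-comm n m _) (∑-cong m (λ l → sym (*-distribˡ-∑ n (c l) _)))

  change-of-basis : ∀ {n N} {V W : Fin N → Mat n} {P R : Mat N} → Independent V →
                    (∀ k l → InF (P k l)) → (∀ k l → InF (R k l)) →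
                    (∀ k → V k ≋ combo (P k) W) → (∀ l → W l ≋ combo (R l) V) → P · R ≋ idM
  change-of-basis {V = V} {W} {P} {R} V-indep P∈F R∈F V≋PW W≋RV k =
    combo-injective V-indep (·-∈F P∈F R∈F k) (idM-∈F k) (begin
      combo ((P · R) k) V                  ≈⟨ combo-combo (P k) R V ⟨
      combo (P k) (λ l → combo (R l) V)    ≈⟨ combo-congʳ (P k) W≋RV ⟨
      combo (P k) W                        ≈⟨ V≋PW k ⟨
      V k                                  ≈⟨ combo-δ V k ⟩
      combo (idM k) V                      ∎)
    where open ≋-Reasoning

  combo-congˡ : ∀ {n m} {c c′ : Fin m → K} (V : Fin m → Mat n) → (∀ k → c k ≡ c′ k) → combo c V ≋ combo c′ V
  combo-congˡ {m = m} V c≗c′ i j = ∑-cong m (λ k → cong (_* V k i j) (c≗c′ k))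

  ·-cancel-outer : ∀ {n} {A A′ B B′ : Mat n} → A′ · A ≋ idM → B · B′ ≋ idM → ∀ M → A′ · (A · M · B) · B′ ≋ M
  ·-cancel-outer {A = A} {A′} {B} {B′} A′A≋I BB′≋I M = begin
      A′ · (A · M · B) · B′        ≈⟨ ·-cong (·-assoc A′ (A · M) B) ≋-refl ⟨
      A′ · (A · M) · B · B′        ≈⟨ ·-assoc (A′ · (A · M)) B B′ ⟩
      A′ · (A · M) · (B · B′)      ≈⟨ ·-cong (≋-sym (·-assoc A′ A M)) BB′≋I ⟩
      A′ · A · M · idM             ≈⟨ ·-identityʳ (A′ · A · M) ⟩
      A′ · A · M                   ≈⟨ ·-cong A′A≋I ≋-refl ⟩
      idM · M                      ≈⟨ ·-identityˡ M ⟩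
      M                            ∎
    where open ≋-Reasoning

  ⟨_,_⟩ : ∀ {n} → Mat n → Mat n → K
  ⟨ W , M ⟩ = tr (W · M)

  pairing-cong : ∀ {n} {W W′ M M′ : Mat n} → W ≋ W′ → M ≋ M′ → ⟨ W , M ⟩ ≡ ⟨ W′ , M′ ⟩
  pairing-cong W≋W′ M≋M′ = tr-cong (·-cong W≋W′ M≋M′)

  pairing-· : ∀ {n} (W X M Y : Mat n) → ⟨ W , X · M · Y ⟩ ≡ ⟨ Y · W · X , M ⟩
  pairing-· W X M Y = begin
      tr (W · (X · M · Y))      ≡⟨ tr-cong (·-assoc W (X · M) Y) ⟨
      tr (W · (X · M) · Y)      ≡⟨ tr-· (W · (X · M)) Y ⟩
      tr (Y · (W · (X · M)))    ≡⟨ tr-cong (·-cong ≋-refl (·-assoc W X M)) ⟨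
      tr (Y · (W · X · M))      ≡⟨ tr-cong (·-assoc Y (W · X) M) ⟨
      tr (Y · (W · X) · M)      ≡⟨ tr-cong (·-cong (·-assoc Y W X) ≋-refl) ⟨
      tr (Y · W · X · M)        ∎
    where open ≡-Reasoning

  pairing-combo : ∀ {n m} (W : Mat n) (c : Fin m → K) (V : Fin m → Mat n) →
                  ⟨ W , combo c V ⟩ ≡ ∑[ l < m ] c l * ⟨ W , V l ⟩
  pairing-combo W c V = trans (tr-cong (·-combo W c V)) (tr-combo c (λ l → W · V l))

  infix 20 _^M_
  _^M_ : ∀ {n} → Mat n → Automorphism → Mat n
  _^M_ = Defs._^M_ E

  module Entrywise (σ : Automorphism) where
    open Defs.Automorphism σ using (ρ; ρ-+; ρ-*)
    open AutomorphismProperties σ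

    ρ-∑ : ∀ m (f : Fin m → K) → ρ (∑ m f) ≡ ∑[ i < m ] ρ (f i)
    ρ-∑ zero    f = ρ-0
    ρ-∑ (suc m) f = trans (ρ-+ (f zero) _) (cong (ρ (f zero) +_) (ρ-∑ m (f ∘ suc)))

    ^M-cong : ∀ {n} {A B : Mat n} → A ≋ B → A ^M σ ≋ B ^M σ
    ^M-cong A≋B i j = cong ρ (A≋B i j)

    ^M-· : ∀ {n} (A B : Mat n) → (A · B) ^M σ ≋ A ^M σ · B ^M σ
    ^M-· {n} A B i j = trans (ρ-∑ n _) (∑-cong n (λ k → ρ-* (A i k) (B k j)))

    ^M-combo : ∀ {n m} (c : Fin m → K) (V : Fin m → Mat n) → combo c V ^M σ ≋ combo (ρ ∘ c) (λ l → V l ^M σ)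
    ^M-combo {m = m} c V i j = trans (ρ-∑ m _) (∑-cong m (λ l → ρ-* (c l) (V l i j)))

    ^M-zero : ∀ {n} {A : Mat n} → A ^M σ ≋ zeroM → A ≋ zeroM
    ^M-zero A^σ≋0 i j = ρ-injective (trans (A^σ≋0 i j) (sym ρ-0))

    _^M⁻¹ : ∀ {n} → Mat n → Mat n
    (A ^M⁻¹) i j = ρ⁻¹ (A i j)

    ^M⁻¹-^M : ∀ {n} (A : Mat n) → (A ^M⁻¹) ^M σ ≋ A
    ^M⁻¹-^M A i j = ρ-ρ⁻¹ (A i j)

    pairing-^M : ∀ {n} (W M : Mat n) → ⟨ W ^M σ , M ^M σ ⟩ ≡ ρ ⟨ W , M ⟩
    pairing-^M {n} W M = sym (trans (ρ-∑ n _) (tr-cong (^M-· W M)))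

  module Sandwich {n} (X Y : Mat n) (σ : Automorphism) where
    open Defs.Automorphism σ using (ρ)
    open AutomorphismProperties σ
    open Entrywise σ

    sandwich : Mat n → Mat n
    sandwich A = X · A ^M σ · Y

    sandwich-cong : ∀ {A B} → A ≋ B → sandwich A ≋ sandwich B
    sandwich-cong A≋B = ·-cong (·-cong ≋-refl (^M-cong A≋B)) ≋-refl

    sandwich-combo : ∀ {m} (c : Fin m → K) (V : Fin m → Mat n) → sandwich (combo c V) ≋ combo (ρ ∘ c) (sandwich ∘ V)
    sandwich-combo c V = begin
        X · combo c V ^M σ · Y                     ≈⟨ ·-cong (·-cong ≋-refl (^M-combo c V)) ≋-refl ⟩
        X · combo (ρ ∘ c) (λ l → V l ^M σ) · Y     ≈⟨ ·-cong (·-combo X (ρ ∘ c) _) ≋-refl ⟩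
        combo (ρ ∘ c) (λ l → X · V l ^M σ) · Y     ≈⟨ combo-· (ρ ∘ c) _ Y ⟩
        combo (ρ ∘ c) (sandwich ∘ V)               ∎
      where open ≋-Reasoning

    pairing-sandwich : ∀ {W W′} → Y · W · X ≋ W′ ^M σ → ∀ A → ⟨ W , sandwich A ⟩ ≡ ρ ⟨ W′ , A ⟩
    pairing-sandwich {W} {W′} YWX≋W′^σ A = begin
        ⟨ W , X · A ^M σ · Y ⟩    ≡⟨ pairing-· W X (A ^M σ) Y ⟩
        ⟨ Y · W · X , A ^M σ ⟩    ≡⟨ pairing-cong YWX≋W′^σ ≋-refl ⟩
        ⟨ W′ ^M σ , A ^M σ ⟩      ≡⟨ pairing-^M W′ A ⟩
        ρ ⟨ W′ , A ⟩              ∎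
      where open ≡-Reasoning

    module _ {X⁻¹ Y⁻¹ : Mat n} (X⁻¹X≋I : X⁻¹ · X ≋ idM) (YY⁻¹≋I : Y · Y⁻¹ ≋ idM) where
      sandwich-zero : ∀ {A} → sandwich A ≋ zeroM → A ≋ zeroM
      sandwich-zero {A} XAY≋0 = ^M-zero (begin
          A ^M σ                   ≈⟨ ·-cancel-outer X⁻¹X≋I YY⁻¹≋I (A ^M σ) ⟨
          X⁻¹ · sandwich A · Y⁻¹   ≈⟨ ·-cong (·-cong ≋-refl XAY≋0) ≋-refl ⟩
          X⁻¹ · zeroM · Y⁻¹        ≈⟨ ·-cong (·-zeroʳ X⁻¹) ≋-refl ⟩
          zeroM · Y⁻¹              ≈⟨ ·-zeroˡ Y⁻¹ ⟩
          zeroM                    ∎)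
        where open ≋-Reasoning

      sandwich-independent : ∀ {m} {V : Fin m → Mat n} → Independent V → Independent (sandwich ∘ V)
      sandwich-independent {V = V} V-indep e e∈F e-combo≋0 k = begin
          e k             ≡⟨ ρ-ρ⁻¹ (e k) ⟨
          ρ (ρ⁻¹ (e k))   ≡⟨ cong ρ (V-indep (ρ⁻¹ ∘ e) (λ l → ρ⁻¹-∈F (e∈F l)) (sandwich-zero untwisted≋0) k) ⟩
          ρ 0#            ≡⟨ ρ-0 ⟩
          0#              ∎
        where
          open ≡-Reasoning
          untwisted≋0 : sandwich (combo (ρ⁻¹ ∘ e) V) ≋ zeroM
          untwisted≋0 = ≋-trans (sandwich-combo (ρ⁻¹ ∘ e) V)
                                (≋-trans (combo-congˡ (sandwich ∘ V) (ρ-ρ⁻¹ ∘ e)) e-combo≋0)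

module RankMetricCodes (E : FieldExt) where
  open FiniteField E
  open Matrices E
  open FieldExt E using (K; s)
  open SpreadSet using (basis)

  vec : ∀ {n} → Mat n → Fin (n *ℕ n) → K
  vec = Defs.vec E

  infix 4 _∈C_
  _∈C_ : ∀ {n} → Mat n → SpreadSet E n → Set
  _∈C_ = Defs._∈C_ E

  infixl 7 _⊙_
  _⊙_ : ∀ {N} → (Fin N → K) → Mat N → Fin N → K
  _⊙_ = Defs._⊙_ E

  vec-combine : ∀ {n} (M : Mat n) j i → vec M (combine j i) ≡ M i j
  vec-combine {n} M j i =
    trans (vec-remQuot (combine j i)) (cong (λ ji → M (proj₂ ji) (proj₁ ji)) (remQuot-combine {n} {n} j i))
    where
      vec-remQuot : ∀ r → vec M r ≡ M (proj₂ (remQuot {n} n r)) (proj₁ (remQuot {n} n r))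
      vec-remQuot r with remQuot {n} n r
      ... | _ = refl

  -- reshape d is the transpose of the matrix whose column-major vectorisation is d,
  -- so that d · vec M = tr (reshape d · M).
  reshape : ∀ {n} → (Fin (n *ℕ n) → K) → Mat n
  reshape d j i = d (combine j i)

  flatten : ∀ {n} → Mat n → Fin (n *ℕ n) → K
  flatten {n} W r = W (proj₁ (remQuot {n} n r)) (proj₂ (remQuot {n} n r))

  reshape-flatten : ∀ {n} (W : Mat n) → reshape (flatten W) ≋ W
  reshape-flatten {n} W j i = cong (λ ji → W (proj₁ ji) (proj₂ ji)) (remQuot-combine {n} {n} j i)

  ∑-vec : ∀ {n} (d : Fin (n *ℕ n) → K) (M : Mat n) → ∑[ r < n *ℕ n ] d r * vec M r ≡ ⟨ reshape d , M ⟩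
  ∑-vec {n} d M =
    trans (∑-combine n n _) (∑-cong n (λ j → ∑-cong n (λ i → cong (d (combine j i) *_) (vec-combine M j i))))

  D⇒pairing : ∀ {n} (C : SpreadSet E n) {v} → D E C v → Σ (Mat n) λ W → ∀ k → v k ≡ ⟨ W , basis C k ⟩
  D⇒pairing C (d , v≈dG) = reshape d , λ k → trans (v≈dG k) (∑-vec d (basis C k))

  pairing⇒D : ∀ {n} (C : SpreadSet E n) (W : Mat n) {v} → (∀ k → v k ≡ ⟨ W , basis C k ⟩) → D E C v
  pairing⇒D C W v≡ = flatten W , λ k →
    trans (v≡ k) (sym (trans (∑-vec (flatten W) (basis C k)) (pairing-cong (reshape-flatten W) ≋-refl)))

  basis-∈C : ∀ {n} (C : SpreadSet E n) k → basis C k ∈C C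
  basis-∈C C k = idM k , idM-∈F k , combo-δ (basis C) k

  module FromSpreadEquivalence {n} (C C′ : SpreadSet E n) (X Y : Mat n) (σ : Automorphism)
    {X⁻¹ Y⁻¹ : Mat n} (X⁻¹X≋I : X⁻¹ · X ≋ idM) (YY⁻¹≋I : Y · Y⁻¹ ≋ idM)
    (C′⊆XCY : ∀ {B} → B ∈C C′ → Σ (Mat n) λ A → A ∈C C × B ≋ X · A ^M σ · Y)
    (XCY⊆C′ : ∀ {A} → A ∈C C → X · A ^M σ · Y ∈C C′)
    where
    open Defs.Automorphism σ using (ρ)
    open AutomorphismProperties σ
    open Entrywise σ
    open Sandwich X Y σ

    N : ℕ
    N = n *ℕ s

    A B : Fin N → Mat n
    A = basis C
    B = basis C′

    B-coordinates : ∀ k → Σ (Fin N → K) λ p → (∀ l → InF (p l)) × B k ≋ combo p (sandwich ∘ A)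
    B-coordinates k with C′⊆XCY (basis-∈C C′ k)
    ... | Â , (c , c∈F , Â≋cA) , Bk≋XÂY =
      ρ ∘ c , (λ l → ρ-∈F (c∈F l)) , ≋-trans Bk≋XÂY (≋-trans (sandwich-cong Â≋cA) (sandwich-combo c A))

    sandwichA∈C′ : ∀ l → sandwich (A l) ∈C C′
    sandwichA∈C′ l = XCY⊆C′ (basis-∈C C l)

    P R : Mat N
    P k = proj₁ (B-coordinates k)
    R l = proj₁ (sandwichA∈C′ l)

    P∈F : ∀ k l → InF (P k l)
    P∈F k = proj₁ (proj₂ (B-coordinates k))

    R∈F : ∀ l m → InF (R l m)
    R∈F l = proj₁ (proj₂ (sandwichA∈C′ l))

    B≋P·sandwichA : ∀ k → B k ≋ combo (P k) (sandwich ∘ A)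
    B≋P·sandwichA k = proj₂ (proj₂ (B-coordinates k))

    sandwichA≋R·B : ∀ l → sandwich (A l) ≋ combo (R l) B
    sandwichA≋R·B l = proj₂ (proj₂ (sandwichA∈C′ l))

    P·R≋I : P · R ≋ idM
    P·R≋I = change-of-basis (SpreadSet.independent C′) P∈F R∈F B≋P·sandwichA sandwichA≋R·B

    R·P≋I : R · P ≋ idM
    R·P≋I = change-of-basis (sandwich-independent X⁻¹X≋I YY⁻¹≋I (SpreadSet.independent C))
                            R∈F P∈F sandwichA≋R·B B≋P·sandwichA

    Pᵀ-invertible : Defs.InvertibleOverF E (P ᵀ)
    Pᵀ-invertible = (λ i j → P∈F j i) , R ᵀ , (λ i j → R∈F j i) , ᵀ-inverse R·P≋I , ᵀ-inverse P·R≋I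

    pairing-basis′ : ∀ {W W′} → Y · W · X ≋ W′ ^M σ → ∀ k → ⟨ W , B k ⟩ ≡ ((λ l → ρ ⟨ W′ , A l ⟩) ⊙ P ᵀ) k
    pairing-basis′ {W} {W′} YWX≋W′^σ k = begin
        ⟨ W , B k ⟩                                   ≡⟨ pairing-cong ≋-refl (B≋P·sandwichA k) ⟩
        ⟨ W , combo (P k) (sandwich ∘ A) ⟩            ≡⟨ pairing-combo W (P k) (sandwich ∘ A) ⟩
        ∑[ l < N ] P k l * ⟨ W , sandwich (A l) ⟩     ≡⟨ ∑-cong N (λ l → trans (*-comm _ _)
                                                            (cong (_* P k l) (pairing-sandwich YWX≋W′^σ (A l)))) ⟩
        ∑[ l < N ] ρ ⟨ W′ , A l ⟩ * P k l             ∎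
      where open ≡-Reasoning

    D′⇒D : ∀ w → D E C′ w → Σ (Fin N → K) λ v → D E C v × (∀ k → w k ≡ ((ρ ∘ v) ⊙ P ᵀ) k)
    D′⇒D w D′w with D⇒pairing C′ D′w
    ... | W , w≡ =
      (λ l → ⟨ W′ , A l ⟩) , pairing⇒D C W′ (λ _ → refl) , λ k → trans (w≡ k) (pairing-basis′ (≋-sym (^M⁻¹-^M _)) k)
      where W′ = (Y · W · X) ^M⁻¹

    D⇒D′ : ∀ w → Σ (Fin N → K) (λ v → D E C v × (∀ k → w k ≡ ((ρ ∘ v) ⊙ P ᵀ) k)) → D E C′ w
    D⇒D′ w (v , Dv , w≈) with D⇒pairing C Dv
    ... | W′ , v≡ = pairing⇒D C′ W (λ k → begin
        w k                                ≡⟨ w≈ k ⟩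
        ((ρ ∘ v) ⊙ P ᵀ) k                  ≡⟨ ∑-cong N (λ l → cong (λ t → ρ t * P k l) (v≡ l)) ⟩
        ((λ l → ρ ⟨ W′ , A l ⟩) ⊙ P ᵀ) k   ≡⟨ pairing-basis′ (·-cancel-outer YY⁻¹≋I X⁻¹X≋I (W′ ^M σ)) k ⟨
        ⟨ W , B k ⟩                        ∎)
      where
        open ≡-Reasoning
        W = Y⁻¹ · W′ ^M σ · X⁻¹

mainTheorem1 : (E : FieldExt) (n : ℕ) (C C' : SpreadSet E n) →
    SpreadEquivalent E C C' → CodeEquivalent E (D E C) (D E C')
mainTheorem1 E n C C′ (X , Y , σ , (X⁻¹ , _ , X⁻¹X≋I) , (Y⁻¹ , YY⁻¹≋I , _) , C′≡XCY) =
  P ᵀ , σ , Pᵀ-invertible , λ w → D′⇒D w , D⇒D′ w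
  where
    open Matrices E using (_ᵀ; ≋-refl)
    open RankMetricCodes.FromSpreadEquivalence E C C′ X Y σ X⁻¹X≋I YY⁻¹≋I
      (proj₁ (C′≡XCY _)) (λ A∈C → proj₂ (C′≡XCY _) (_ , A∈C , ≋-refl))
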